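{- Let $\mathcal{G}_{12,\mathrm{forest}}$ be the set of all permutations $\pi$ such that the occurrence graph $G_{12}(\pi)$ is a forest. Then \[ \mathcal{G}_{12,\mathrm{forest}} = \mathrm{Av}(123, 1432, 2143, 3214). \]
   Context: Permutations of all lengths $n\ge0$ are considered. For a permutation $\pi$ of length $n$, $V_{12}(\pi)$ is the set of pairs $\{i,j\}$ with $1\le i<j\le n$ and $\pi(i)<\pi(j)$, and the occurrence graph $G_{12}(\pi)$ is the simple undirected graph with vertex set $V_{12}(\pi)$ in which two vertices are adjacent iff they share exactly one element. A forest is a graph with no cycles (a disjoint union of trees); the graph with no vertices is a forest. A permutation $\pi$ contains a permutation $q$ of length $k$ if there are indices $i_1<\dots<i_k$ with $\pi(i_1)\cdots\pi(i_k)$ order-isomorphic to $q$, and avoids $q$ otherwise; $\mathrm{Av}(M)$ is the set of permutations avoiding every element of $M$. -}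

module Defs where

open import Data.Nat using (ℕ; _≥_)
open import Data.Fin using (Fin; zero; suc; _<_; toℕ; inject₁; fromℕ; #_)
open import Data.Fin.Permutation using (Permutation′; _⟨$⟩ʳ_)
open import Data.Vec using (Vec; []; _∷_; lookup)
open import Data.List using (List; []; _∷_)
open import Data.List.Relation.Unary.All using (All)
open import Data.Product using (Σ; _×_; _,_; ∃; proj₁)
open import Data.Sum using (_⊎_)
open import Relation.Binary.PropositionalEquality using (_≡_; _≢_)
open import Relation.Nullary using (¬_)
open import Function using (_⇔_)

-- Permutations of length n are elements of Permutation′ n (bijections
-- Fin n → Fin n); positions and values are 0-indexed.

StrictlyIncreasing : ∀ {k n} → (Fin k → Fin n) → Set
StrictlyIncreasing f = ∀ a b → a < b → f a < f b

OrderIso : ∀ {k m l} → (Fin k → Fin m) → (Fin k → Fin l) → Set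
OrderIso w q = ∀ a b → (w a < w b) ⇔ (q a < q b)

-- π contains the pattern q of length k
-- (the pattern q is given by its one-line notation q(0) … q(k-1), 0-indexed)
Contains : ∀ {n k} → Permutation′ n → Vec (Fin k) k → Set
Contains {n} {k} π q =
  Σ (Fin k → Fin n) λ f →
    StrictlyIncreasing f × OrderIso (λ a → π ⟨$⟩ʳ f a) (lookup q)

Avoids : ∀ {n k} → Permutation′ n → Vec (Fin k) k → Set
Avoids π q = ¬ Contains π q

Pattern : Set
Pattern = Σ ℕ λ k → Vec (Fin k) k

InAv : ∀ {n} → List Pattern → Permutation′ n → Set
InAv M π = All (λ { (k , q) → Avoids π q }) M

record Graph : Set₁ where
  field
    Vertex : Set
    Adj    : Vertex → Vertex → Set

-- a cycle: k = j+1 ≥ 3 pairwise distinct vertices c₀ … c_j with c_m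
-- adjacent to c_{m+1} (m < j) and c_j adjacent to c₀
record Cycle (G : Graph) : Set where
  open Graph G
  field
    j      : ℕ
    long   : j ≥ 2
    c      : Fin (ℕ.suc j) → Vertex
    inj    : ∀ a b → c a ≡ c b → a ≡ b
    steps  : ∀ (m : Fin j) → Adj (c (inject₁ m)) (c (suc m))
    close  : Adj (c (fromℕ j)) (c zero)

IsForest : Graph → Set
IsForest G = ¬ Cycle G

-- V₁₂(π): pairs {i,j} with i < j and π(i) < π(j), stored as (i , j) with i < j
V12 : ∀ {n} → Permutation′ n → Set
V12 {n} π = Σ (Fin n × Fin n) λ { (i , j) → i < j × (π ⟨$⟩ʳ i) < (π ⟨$⟩ʳ j) }

ShareExactlyOne : ∀ {n} → Fin n × Fin n → Fin n × Fin n → Set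
ShareExactlyOne (i , j) (k , l) =
    (i ≡ k × i ≢ l × j ≢ k × j ≢ l)
  ⊎ (i ≢ k × i ≡ l × j ≢ k × j ≢ l)
  ⊎ (i ≢ k × i ≢ l × j ≡ k × j ≢ l)
  ⊎ (i ≢ k × i ≢ l × j ≢ k × j ≡ l)

G12 : ∀ {n} → Permutation′ n → Graph
G12 π = record
  { Vertex = V12 π
  ; Adj    = λ u v → ShareExactlyOne (proj₁ u) (proj₁ v)
  }

-- The patterns 123, 1432, 2143, 3214 (0-indexed values)

p123 p1432 p2143 p3214 : Pattern
p123  = 3 , (# 0 ∷ # 1 ∷ # 2 ∷ [])
p1432 = 4 , (# 0 ∷ # 3 ∷ # 2 ∷ # 1 ∷ [])
p2143 = 4 , (# 1 ∷ # 0 ∷ # 3 ∷ # 2 ∷ [])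
p3214 = 4 , (# 2 ∷ # 1 ∷ # 0 ∷ # 3 ∷ [])

module Submission where

-- (⇒) Each pattern yields a short cycle.  An occurrence at positions
--     a < b < c (< d) gives the triangle {ab, bc, ac} for 123, the triangle
--     {ab, ac, ad} for 1432, the triangle {ad, bd, cd} for 3214 and the
--     square ac – ad – bd – bc for 2143.
-- (⇐) Let π avoid the four patterns and suppose G₁₂(π) has a cycle.  Take
--     the cycle vertex C = {v, a} (v < a) that is least in the
--     lexicographic order of pairs.  Its two cycle neighbours are distinct,
--     share one element with C and are lexicographically larger, so
--     (avoiding 123) each has the form {v, b} with a < b or {x, a} with
--     v < x.  Each of the three ways to combine two such neighbours forces
--     an occurrence of 123, 1432, 3214 or 2143.

open import Defs
open import Data.Nat as ℕ using (ℕ; zero; suc; _*_; z≤n; s≤s)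
import Data.Nat.Properties as ℕP
open import Data.Fin using (Fin; zero; suc; toℕ; inject₁; fromℕ; combine; _<_; _≤_; _<?_)
open import Data.Fin.Properties
  using (<-trans; <-cmp; <-irrefl; <-asym; <⇒≢; ≤∧≢⇒<; <-irrelevant;
         toℕ-fromℕ; toℕ-inject₁; toℕ-combine; combine-monoˡ-<; ≤-totalOrder)
open import Data.Fin.Patterns using (0F; 1F; 2F; 3F)
open import Data.Fin.Permutation using (Permutation′; _⟨$⟩ʳ_; _⟨$⟩ˡ_; inverseˡ)
open import Data.Vec using (Vec; []; _∷_; lookup)
open import Data.List using ([]; _∷_; allFin)
open import Data.List.Membership.Propositional.Properties using (∈-allFin)
open import Data.List.Relation.Unary.All using ([]; _∷_)
import Data.List.Relation.Unary.All as All
import Data.List.Extrema as Extrema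
open import Data.Product using (Σ; ∃₂; _×_; _,_; proj₁; proj₂; uncurry)
open import Data.Sum using (_⊎_; inj₁; inj₂)
open import Data.Empty using (⊥; ⊥-elim)
open import Relation.Binary.PropositionalEquality
open import Relation.Binary using (tri<; tri≈; tri>)
open import Relation.Nullary using (¬_; contradiction)
open import Relation.Nullary.Decidable using (True; toWitness)
open import Function using (_⇔_; _∘_; mk⇔; Equivalence)

increasing-by-steps : ∀ {k n} (g : Fin (suc k) → Fin n) →
  (∀ (i : Fin k) → g (inject₁ i) < g (suc i)) → StrictlyIncreasing g
increasing-by-steps {suc k} g step zero (suc zero) _ = step zero
increasing-by-steps {suc k} g step zero (suc (suc b)) _ =
  <-trans (step zero) (increasing-by-steps (g ∘ suc) (step ∘ suc) zero (suc b) (s≤s z≤n))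
increasing-by-steps {suc k} g step (suc a) (suc b) (s≤s a<b) =
  increasing-by-steps (g ∘ suc) (step ∘ suc) a b a<b

ordered : ∀ {k n} {g : Fin k → Fin n} → StrictlyIncreasing g →
  ∀ a b → {a<b : True (a <? b)} → g a < g b
ordered increasing a b {a<b} = increasing a b (toWitness a<b)

-- w is order-isomorphic to q whenever w ∘ r is increasing for a left
-- inverse r of q: q is then injective, and w reflects the order of q.
orderIso-via-inverse : ∀ {k m l} (w : Fin k → Fin m) (q : Fin k → Fin l)
  (r : Fin l → Fin k) → (∀ a → r (q a) ≡ a) → StrictlyIncreasing (w ∘ r) →
  OrderIso w q
orderIso-via-inverse w q r r∘q≗id increasing a b = mk⇔ reflect preserve
  where
  preserve : ∀ {a b} → q a < q b → w a < w b
  preserve {a} {b} qa<qb =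
    subst₂ (λ x y → w x < w y) (r∘q≗id a) (r∘q≗id b) (increasing (q a) (q b) qa<qb)

  q-injective : ∀ {a b} → q a ≡ q b → a ≡ b
  q-injective {a} {b} qa≡qb = trans (sym (r∘q≗id a)) (trans (cong r qa≡qb) (r∘q≗id b))

  reflect : w a < w b → q a < q b
  reflect wa<wb with <-cmp (q a) (q b)
  ... | tri< qa<qb _ _ = qa<qb
  ... | tri≈ _ qa≡qb _ = contradiction wa<wb (<-irrefl (cong w (q-injective qa≡qb)))
  ... | tri> _ _ qb<qa = contradiction (preserve qb<qa) (<-asym wa<wb)

minimum : ∀ {m k} (g : Fin (suc m) → Fin k) → Σ (Fin (suc m)) λ i → ∀ i′ → g i ≤ g i′
minimum {m} {k} g =
  argmin g zero (allFin (suc m)) ,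
  λ i′ → All.lookup (f[argmin]≤f[xs] {f = g} zero (allFin (suc m))) (∈-allFin i′)
  where open Extrema (≤-totalOrder k)

data LastView {j : ℕ} : Fin (suc j) → Set where
  last  : LastView (fromℕ j)
  inner : (m : Fin j) → LastView (inject₁ m)

lastView : ∀ {j} (i : Fin (suc j)) → LastView i
lastView {zero}  zero    = last
lastView {suc j} zero    = inner zero
lastView {suc j} (suc i) with lastView i
... | last    = last
... | inner m = inner (suc m)

-- Index t has cyclic predecessor p and successor s modulo j + 1; when the
-- cycle has at least three indices these two differ.
predecessor≢successor : ∀ {j t p s} → 2 ℕ.≤ j →
  (t ≡ suc p ⊎ t ≡ 0 × p ≡ j) → (s ≡ suc t ⊎ t ≡ j × s ≡ 0) → p ≢ s
predecessor≢successor _           (inj₁ refl)          (inj₁ refl)          ()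
predecessor≢successor (s≤s ())    (inj₁ refl)          (inj₂ (refl , refl)) refl
predecessor≢successor (s≤s ())    (inj₂ (refl , refl)) (inj₁ refl)          refl

module _ (G : Graph) where
  open Graph G

  triangle : (∀ {x} → ¬ Adj x x) → (∀ {x y} → Adj x y → Adj y x) →
    ∀ u₀ u₁ u₂ → Adj u₀ u₁ → Adj u₁ u₂ → Adj u₀ u₂ → Cycle G
  triangle loopless symmetric u₀ u₁ u₂ u₀u₁ u₁u₂ u₀u₂ = record
    { j = 2 ; long = s≤s (s≤s z≤n) ; c = vertex ; inj = injective
    ; steps = λ { 0F → u₀u₁ ; 1F → u₁u₂ } ; close = symmetric u₀u₂ }
    where
    vertex : Fin 3 → Vertex
    vertex = lookup (u₀ ∷ u₁ ∷ u₂ ∷ [])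

    distinct : ∀ {x y} → Adj x y → x ≢ y
    distinct xy refl = loopless xy

    injective : ∀ a b → vertex a ≡ vertex b → a ≡ b
    injective 0F 0F _ = refl
    injective 1F 1F _ = refl
    injective 2F 2F _ = refl
    injective 0F 1F e = ⊥-elim (distinct u₀u₁ e)
    injective 1F 0F e = ⊥-elim (distinct u₀u₁ (sym e))
    injective 1F 2F e = ⊥-elim (distinct u₁u₂ e)
    injective 2F 1F e = ⊥-elim (distinct u₁u₂ (sym e))
    injective 0F 2F e = ⊥-elim (distinct u₀u₂ e)
    injective 2F 0F e = ⊥-elim (distinct u₀u₂ (sym e))

  square : (∀ {x} → ¬ Adj x x) → ∀ u₀ u₁ u₂ u₃ →
    Adj u₀ u₁ → Adj u₁ u₂ → Adj u₂ u₃ → Adj u₃ u₀ →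
    u₀ ≢ u₂ → u₁ ≢ u₃ → Cycle G
  square loopless u₀ u₁ u₂ u₃ u₀u₁ u₁u₂ u₂u₃ u₃u₀ u₀≢u₂ u₁≢u₃ = record
    { j = 3 ; long = s≤s (s≤s z≤n) ; c = vertex ; inj = injective
    ; steps = λ { 0F → u₀u₁ ; 1F → u₁u₂ ; 2F → u₂u₃ } ; close = u₃u₀ }
    where
    vertex : Fin 4 → Vertex
    vertex = lookup (u₀ ∷ u₁ ∷ u₂ ∷ u₃ ∷ [])

    distinct : ∀ {x y} → Adj x y → x ≢ y
    distinct xy refl = loopless xy

    injective : ∀ a b → vertex a ≡ vertex b → a ≡ b
    injective 0F 0F _ = refl
    injective 1F 1F _ = refl
    injective 2F 2F _ = refl
    injective 3F 3F _ = refl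
    injective 0F 1F e = ⊥-elim (distinct u₀u₁ e)
    injective 1F 0F e = ⊥-elim (distinct u₀u₁ (sym e))
    injective 1F 2F e = ⊥-elim (distinct u₁u₂ e)
    injective 2F 1F e = ⊥-elim (distinct u₁u₂ (sym e))
    injective 2F 3F e = ⊥-elim (distinct u₂u₃ e)
    injective 3F 2F e = ⊥-elim (distinct u₂u₃ (sym e))
    injective 3F 0F e = ⊥-elim (distinct u₃u₀ e)
    injective 0F 3F e = ⊥-elim (distinct u₃u₀ (sym e))
    injective 0F 2F e = ⊥-elim (u₀≢u₂ e)
    injective 2F 0F e = ⊥-elim (u₀≢u₂ (sym e))
    injective 1F 3F e = ⊥-elim (u₁≢u₃ e)
    injective 3F 1F e = ⊥-elim (u₁≢u₃ (sym e))

  module _ (C : Cycle G) where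
    open Cycle C

    predecessor : ∀ t → Σ (Fin (suc j)) λ p → Adj (c p) (c t) ×
                    (toℕ t ≡ suc (toℕ p) ⊎ toℕ t ≡ 0 × toℕ p ≡ j)
    predecessor zero    = fromℕ j , close , inj₂ (refl , toℕ-fromℕ j)
    predecessor (suc m) = inject₁ m , steps m , inj₁ (cong suc (sym (toℕ-inject₁ m)))

    successor : ∀ t → Σ (Fin (suc j)) λ s → Adj (c t) (c s) ×
                  (toℕ s ≡ suc (toℕ t) ⊎ toℕ t ≡ j × toℕ s ≡ 0)
    successor t with lastView t
    ... | last    = zero , close , inj₂ (toℕ-fromℕ j , refl)
    ... | inner m = suc m , steps m , inj₁ (cong suc (sym (toℕ-inject₁ m)))

    cycle-neighbours : ∀ i → ∃₂ λ p s → Adj (c p) (c i) × Adj (c i) (c s) × c p ≢ c s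
    cycle-neighbours i with predecessor i | successor i
    ... | p , cp~ci , p-index | s , ci~cs , s-index =
      p , s , cp~ci , ci~cs ,
      λ cp≡cs → predecessor≢successor long p-index s-index (cong toℕ (inj p s cp≡cs))

module _ {n} {i j k : Fin n} (i<j : i < j) (j<k : j < k) where
  private
    i<k : i < k
    i<k = <-trans i<j j<k

    ≢-from-< : ∀ {x y : Fin n} → x < y → y ≢ x
    ≢-from-< x<y = <⇒≢ x<y ∘ sym

  share-first : ShareExactlyOne (i , j) (i , k)
  share-first = inj₁ (refl , <⇒≢ i<k , ≢-from-< i<j , <⇒≢ j<k)

  share-last : ShareExactlyOne (i , k) (j , k)
  share-last = inj₂ (inj₂ (inj₂ (<⇒≢ i<j , <⇒≢ i<k , ≢-from-< j<k , refl)))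

  share-middle : ShareExactlyOne (i , j) (j , k)
  share-middle = inj₂ (inj₂ (inj₁ (<⇒≢ i<j , <⇒≢ i<k , refl , <⇒≢ j<k)))

share-sym : ∀ {n} {x y : Fin n × Fin n} → ShareExactlyOne x y → ShareExactlyOne y x
share-sym (inj₁ (e , a , b , c)) = inj₁ (sym e , b ∘ sym , a ∘ sym , c ∘ sym)
share-sym (inj₂ (inj₁ (a , e , b , c))) =
  inj₂ (inj₂ (inj₁ (a ∘ sym , b ∘ sym , sym e , c ∘ sym)))
share-sym (inj₂ (inj₂ (inj₁ (a , b , e , c)))) =
  inj₂ (inj₁ (a ∘ sym , sym e , b ∘ sym , c ∘ sym))
share-sym (inj₂ (inj₂ (inj₂ (a , b , c , e)))) =
  inj₂ (inj₂ (inj₂ (a ∘ sym , c ∘ sym , b ∘ sym , sym e)))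

share-irrefl : ∀ {n} {x : Fin n × Fin n} → ¬ ShareExactlyOne x x
share-irrefl (inj₁ (_ , _ , _ , j≢j)) = j≢j refl
share-irrefl (inj₂ (inj₁ (i≢i , _))) = i≢i refl
share-irrefl (inj₂ (inj₂ (inj₁ (i≢i , _)))) = i≢i refl
share-irrefl (inj₂ (inj₂ (inj₂ (i≢i , _)))) = i≢i refl

-- The rank of a pair of positions in the lexicographic order, and the two
-- facts we use about it: a pair of larger rank has a first component at
-- least as large, and with equal first components a second component at
-- least as large.
rank : ∀ {n} → Fin n × Fin n → Fin (n * n)
rank = uncurry combine

rank-first : ∀ {n} {v a x y : Fin n} → rank (v , a) ≤ rank (x , y) → toℕ v ℕ.≤ toℕ x
rank-first {a = a} {y = y} le = ℕP.≮⇒≥ λ x<v → ℕP.<⇒≱ (combine-monoˡ-< y a x<v) le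

rank-second : ∀ {n} {v a b : Fin n} → rank (v , a) ≤ rank (v , b) → toℕ a ℕ.≤ toℕ b
rank-second {n} {v} {a} {b} le =
  ℕP.+-cancelˡ-≤ (n * toℕ v) _ _ (subst₂ ℕ._≤_ (toℕ-combine v a) (toℕ-combine v b) le)

module OccurrenceGraph {n : ℕ} (π : Permutation′ n) where

  val : Fin n → Fin n
  val i = π ⟨$⟩ʳ i

  val-injective : ∀ {x y} → val x ≡ val y → x ≡ y
  val-injective {x} {y} e = begin
    x                     ≡⟨ inverseˡ π ⟨
    π ⟨$⟩ˡ val x          ≡⟨ cong (π ⟨$⟩ˡ_) e ⟩
    π ⟨$⟩ˡ val y          ≡⟨ inverseˡ π ⟩
    y                     ∎
    where open ≡-Reasoning

  compare-values : ∀ {x y} → x < y → val x < val y ⊎ val y < val x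
  compare-values {x} {y} x<y with <-cmp (val x) (val y)
  ... | tri< lt _ _ = inj₁ lt
  ... | tri≈ _ e _  = ⊥-elim (<⇒≢ x<y (val-injective e))
  ... | tri> _ _ gt = inj₂ gt

  vertex-≡ : (u w : V12 π) → proj₁ u ≡ proj₁ w → u ≡ w
  vertex-≡ (_ , p , q) (_ , p′ , q′) refl =
    cong₂ (λ x y → _ , x , y) (<-irrelevant p p′) (<-irrelevant q q′)

  occurrence : ∀ {k} (q : Vec (Fin (suc k)) (suc k)) →
    (∀ a → lookup q (lookup q a) ≡ a) → (f : Fin (suc k) → Fin n) →
    (∀ i → f (inject₁ i) < f (suc i)) →
    (∀ i → val (f (lookup q (inject₁ i))) < val (f (lookup q (suc i)))) →
    Contains π q
  occurrence q involutive f positions values =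
    f , increasing-by-steps f positions ,
    orderIso-via-inverse (val ∘ f) (lookup q) (lookup q) involutive
      (increasing-by-steps (val ∘ f ∘ lookup q) values)

  -- Occurrences of the four patterns at positions a < b < c (< d), each
  -- given by its values listed in increasing order.
  module _ {a b c : Fin n} (a<b : a < b) (b<c : b < c) where
    contains123 : val a < val b → val b < val c → Contains π (proj₂ p123)
    contains123 v₁ v₂ =
      occurrence (proj₂ p123) (λ { 0F → refl ; 1F → refl ; 2F → refl })
        (lookup (a ∷ b ∷ c ∷ [])) (λ { 0F → a<b ; 1F → b<c }) (λ { 0F → v₁ ; 1F → v₂ })

    module _ {d : Fin n} (c<d : c < d) where
      private
        quadruple : Fin 4 → Fin n
        quadruple = lookup (a ∷ b ∷ c ∷ d ∷ [])

        positions : ∀ i → quadruple (inject₁ i) < quadruple (suc i)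
        positions = λ { 0F → a<b ; 1F → b<c ; 2F → c<d }

      contains1432 : val a < val d → val d < val c → val c < val b → Contains π (proj₂ p1432)
      contains1432 v₁ v₂ v₃ =
        occurrence (proj₂ p1432)
          (λ { 0F → refl ; 1F → refl ; 2F → refl ; 3F → refl }) quadruple positions
          (λ { 0F → v₁ ; 1F → v₂ ; 2F → v₃ })

      contains2143 : val b < val a → val a < val d → val d < val c → Contains π (proj₂ p2143)
      contains2143 v₁ v₂ v₃ =
        occurrence (proj₂ p2143)
          (λ { 0F → refl ; 1F → refl ; 2F → refl ; 3F → refl }) quadruple positions
          (λ { 0F → v₁ ; 1F → v₂ ; 2F → v₃ })

      contains3214 : val c < val b → val b < val a → val a < val d → Contains π (proj₂ p3214)
      contains3214 v₁ v₂ v₃ =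
        occurrence (proj₂ p3214)
          (λ { 0F → refl ; 1F → refl ; 2F → refl ; 3F → refl }) quadruple positions
          (λ { 0F → v₁ ; 1F → v₂ ; 2F → v₃ })

  module Occurrence {k} (q : Vec (Fin k) k) (occ : Contains π q) where
    at : Fin k → Fin n
    at = proj₁ occ

    at< : ∀ a b → {a<b : True (a <? b)} → at a < at b
    at< = ordered (proj₁ (proj₂ occ))

    pair : ∀ a b → {a<b : True (a <? b)} → {qa<qb : True (lookup q a <? lookup q b)} → V12 π
    pair a b {a<b} {qa<qb} =
      (at a , at b) , at< a b {a<b} , Equivalence.from (proj₂ (proj₂ occ) a b) (toWitness qa<qb)

  triangle₁₂ : ∀ u₀ u₁ u₂ → ShareExactlyOne (proj₁ u₀) (proj₁ u₁) →
    ShareExactlyOne (proj₁ u₁) (proj₁ u₂) → ShareExactlyOne (proj₁ u₀) (proj₁ u₂) →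
    Cycle (G12 π)
  triangle₁₂ = triangle (G12 π) share-irrefl share-sym

  cycle123 : Contains π (proj₂ p123) → Cycle (G12 π)
  cycle123 occ = triangle₁₂ (pair 0F 1F) (pair 1F 2F) (pair 0F 2F)
    (share-middle (at< 0F 1F) (at< 1F 2F))
    (share-sym (share-last (at< 0F 1F) (at< 1F 2F)))
    (share-first (at< 0F 1F) (at< 1F 2F))
    where open Occurrence (proj₂ p123) occ

  cycle1432 : Contains π (proj₂ p1432) → Cycle (G12 π)
  cycle1432 occ = triangle₁₂ (pair 0F 1F) (pair 0F 2F) (pair 0F 3F)
    (share-first (at< 0F 1F) (at< 1F 2F)) (share-first (at< 0F 2F) (at< 2F 3F))
    (share-first (at< 0F 1F) (at< 1F 3F))
    where open Occurrence (proj₂ p1432) occ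

  cycle3214 : Contains π (proj₂ p3214) → Cycle (G12 π)
  cycle3214 occ = triangle₁₂ (pair 0F 3F) (pair 1F 3F) (pair 2F 3F)
    (share-last (at< 0F 1F) (at< 1F 3F)) (share-last (at< 1F 2F) (at< 2F 3F))
    (share-last (at< 0F 2F) (at< 2F 3F))
    where open Occurrence (proj₂ p3214) occ

  cycle2143 : Contains π (proj₂ p2143) → Cycle (G12 π)
  cycle2143 occ =
    square (G12 π) share-irrefl (pair 0F 2F) (pair 0F 3F) (pair 1F 3F) (pair 1F 2F)
    (share-first (at< 0F 2F) (at< 2F 3F)) (share-last (at< 0F 1F) (at< 1F 3F))
    (share-sym (share-first (at< 1F 2F) (at< 2F 3F)))
    (share-sym (share-last (at< 0F 1F) (at< 1F 2F)))
    (λ e → <⇒≢ (at< 0F 1F) (cong (proj₁ ∘ proj₁) e))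
    (λ e → <⇒≢ (at< 0F 1F) (cong (proj₁ ∘ proj₁) e))
    where open Occurrence (proj₂ p2143) occ

  forest⇒avoids : IsForest (G12 π) → InAv (p123 ∷ p1432 ∷ p2143 ∷ p3214 ∷ []) π
  forest⇒avoids forest =
    forest ∘ cycle123 ∷ forest ∘ cycle1432 ∷ forest ∘ cycle2143 ∷ forest ∘ cycle3214 ∷ []

  module Avoiding (avoid123  : Avoids π (proj₂ p123))  (avoid1432 : Avoids π (proj₂ p1432))
                  (avoid2143 : Avoids π (proj₂ p2143)) (avoid3214 : Avoids π (proj₂ p3214)) where

    no-two-right-extensions : ∀ {v a p q} → v < a → a < p → p < q →
      val v < val a → val v < val p → val v < val q → ⊥
    no-two-right-extensions v<a a<p p<q va vp vq with compare-values a<p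
    ... | inj₁ ap = avoid123 (contains123 v<a a<p va ap)
    ... | inj₂ pa with compare-values p<q
    ...   | inj₁ pq = avoid123 (contains123 (<-trans v<a a<p) p<q vp pq)
    ...   | inj₂ qp = avoid1432 (contains1432 v<a a<p p<q vq qp pa)

    no-two-left-extensions : ∀ {v x y a} → v < x → x < y → y < a →
      val v < val a → val x < val a → val y < val a → ⊥
    no-two-left-extensions v<x x<y y<a va xa ya with compare-values x<y
    ... | inj₁ xy = avoid123 (contains123 x<y y<a xy ya)
    ... | inj₂ yx with compare-values v<x
    ...   | inj₁ vx = avoid123 (contains123 v<x (<-trans x<y y<a) vx xa)
    ...   | inj₂ xv = avoid3214 (contains3214 v<x x<y y<a yx xv va)

    no-two-sided-extensions : ∀ {v x a b} → v < x → x < a → a < b →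
      val v < val a → val x < val a → val v < val b → ⊥
    no-two-sided-extensions v<x x<a a<b va xa vb with compare-values v<x
    ... | inj₁ vx = avoid123 (contains123 v<x x<a vx xa)
    ... | inj₂ xv with compare-values a<b
    ...   | inj₁ ab = avoid123 (contains123 (<-trans v<x x<a) a<b va ab)
    ...   | inj₂ ba = avoid2143 (contains2143 v<x x<a a<b xv vb ba)

    data Extension : Fin n × Fin n → Fin n × Fin n → Set where
      to-the-right : ∀ {v a b} → a < b → val v < val b → Extension (v , a) (v , b)
      to-the-left  : ∀ {v a x} → v < x → x < a → val x < val a → Extension (v , a) (x , a)

    -- A lexicographically larger neighbour of C in G₁₂(π) extends C; the
    -- remaining overlaps either contradict the rank order or give 123.
    classify : (C u : V12 π) → ShareExactlyOne (proj₁ u) (proj₁ C) →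
      rank (proj₁ C) ≤ rank (proj₁ u) → Extension (proj₁ C) (proj₁ u)
    classify _ (_ , _ , xy) (inj₁ (refl , _ , _ , y≢a)) C≤u =
      to-the-right (≤∧≢⇒< (rank-second C≤u) (y≢a ∘ sym)) xy
    classify (_ , v<a , va) (_ , a<y , ay) (inj₂ (inj₁ (_ , refl , _ , _))) _ =
      ⊥-elim (avoid123 (contains123 v<a a<y va ay))
    classify _ (_ , x<v , _) (inj₂ (inj₂ (inj₁ (_ , _ , refl , _)))) C≤u =
      ⊥-elim (ℕP.<⇒≱ x<v (rank-first C≤u))
    classify _ (_ , x<a , xa) (inj₂ (inj₂ (inj₂ (x≢v , _ , _ , refl)))) C≤u =
      to-the-left (≤∧≢⇒< (rank-first C≤u) (x≢v ∘ sym)) x<a xa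

    extensions-coincide : ∀ (C : V12 π) {M N} →
      Extension (proj₁ C) M → Extension (proj₁ C) N → M ≡ N
    extensions-coincide (_ , v<a , va)
      (to-the-right {b = b} a<b vb) (to-the-right {b = b′} a<b′ vb′)
      with <-cmp b b′
    ... | tri< b<b′ _ _ = ⊥-elim (no-two-right-extensions v<a a<b b<b′ va vb vb′)
    ... | tri≈ _ refl _ = refl
    ... | tri> _ _ b′<b = ⊥-elim (no-two-right-extensions v<a a<b′ b′<b va vb′ vb)
    extensions-coincide (_ , v<a , va)
      (to-the-left {x = x} v<x x<a xa) (to-the-left {x = x′} v<x′ x′<a x′a)
      with <-cmp x x′
    ... | tri< x<x′ _ _ = ⊥-elim (no-two-left-extensions v<x x<x′ x′<a va xa x′a)
    ... | tri≈ _ refl _ = refl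
    ... | tri> _ _ x′<x = ⊥-elim (no-two-left-extensions v<x′ x′<x x<a va x′a xa)
    extensions-coincide (_ , _ , va) (to-the-right a<b vb) (to-the-left v<x x<a xa) =
      ⊥-elim (no-two-sided-extensions v<x x<a a<b va xa vb)
    extensions-coincide (_ , _ , va) (to-the-left v<x x<a xa) (to-the-right a<b vb) =
      ⊥-elim (no-two-sided-extensions v<x x<a a<b va xa vb)

    -- The lexicographically least vertex of a cycle would have two distinct
    -- larger neighbours on it.
    avoids⇒forest : IsForest (G12 π)
    avoids⇒forest cycle =
      let open Cycle cycle
          (m , least) = minimum (rank ∘ proj₁ ∘ c)
          (p , s , p~m , m~s , cp≢cs) = cycle-neighbours (G12 π) cycle m
      in cp≢cs (vertex-≡ (c p) (c s)
           (extensions-coincide (c m) (classify (c m) (c p) p~m (least p))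
                                      (classify (c m) (c s) (share-sym m~s) (least s))))

theorem5p6 : ∀ (n : ℕ) (π : Permutation′ n) →
    IsForest (G12 π) ⇔ InAv (p123 ∷ p1432 ∷ p2143 ∷ p3214 ∷ []) π
theorem5p6 n π = mk⇔ forest⇒avoids avoids⇒forest
  where
  open OccurrenceGraph π

  avoids⇒forest : InAv (p123 ∷ p1432 ∷ p2143 ∷ p3214 ∷ []) π → IsForest (G12 π)
  avoids⇒forest (avoid123 ∷ avoid1432 ∷ avoid2143 ∷ avoid3214 ∷ []) =
    Avoiding.avoids⇒forest avoid123 avoid1432 avoid2143 avoid3214
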